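{- In System $\mathsf{F}_\wedge$, if $\Theta\vdash T_0<:S_0$ and $\Theta,X<:S_0\vdash S_1<:T_1$, then $\Theta\vdash\forall X.S_1[X\wedge S_0/X]<:\forall X.T_1[X\wedge T_0/X^-]$.
   Context: System $\mathsf{F}_\wedge$. Types: $T ::= \top\mid X\mid T\to T\mid\forall X.T\mid T\wedge T$ (up to $\alpha$-conversion). Contexts are finite sequences of assumptions $X<:T$ and $x:T$ ($T$ any $\mathsf{F}_\wedge$-type) with the usual well-formedness judgment. Subtyping $\Theta\vdash S<:T$ is generated by: (Var) $\Theta,X<:T,\Theta'\vdash X<:T$; (Top) $\Theta\vdash T<:\top$; (Refl); (Trans); ($\to$) from $\Theta\vdash S'<:S$, $\Theta\vdash T<:T'$ infer $\Theta\vdash S\to T<:S'\to T'$; ($\forall$) from $\Theta,X<:\top\vdash S<:T$ infer $\Theta\vdash\forall X.S<:\forall X.T$; $S\wedge S'<:S$; $S\wedge S'<:S'$; $T<:S\wedge S'$ from $T<:S$ and $T<:S'$. $T[R/X]$ is capture-avoiding substitution. Mixed substitution $T[(S_-,S_+)/X]$: $X[(S_-,S_+)/X]=S_+$; $Y[(S_-,S_+)/X]=Y$ for $Y\not\equiv X$; $\top[(S_-,S_+)/X]=\top$; $(T\to T')[(S_-,S_+)/X]=T[(S_+,S_-)/X]\to T'[(S_-,S_+)/X]$; $(\forall Y.T)[(S_-,S_+)/X]=\forall Y.T[(S_-,S_+)/X]$; $(T\wedge T')[(S_-,S_+)/X]=T[(S_-,S_+)/X]\wedge T'[(S_-,S_+)/X]$.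 $T[R/X^-]$ abbreviates $T[(R,X)/X]$. -}

module Defs where

open import Data.Nat using (ℕ; zero; suc)
open import Data.Fin using (Fin; zero; suc)

-- Types of System F∧, intrinsically scoped with de Bruijn indices
-- (this realises "up to α-conversion"). Ty n = types with n free type variables.
data Ty (n : ℕ) : Set where
  ⊤'   : Ty n
  var  : Fin n → Ty n
  _⇒_  : Ty n → Ty n → Ty n
  ∀'   : Ty (suc n) → Ty n
  _∧_  : Ty n → Ty n → Ty n

infixr 7 _⇒_
infixl 8 _∧_

Ren : ℕ → ℕ → Set
Ren m n = Fin m → Fin n

liftR : ∀ {m n} → Ren m n → Ren (suc m) (suc n)
liftR ρ zero    = zero
liftR ρ (suc i) = suc (ρ i)

ren : ∀ {m n} → Ren m n → Ty m → Ty n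
ren ρ ⊤'       = ⊤'
ren ρ (var i)  = var (ρ i)
ren ρ (S ⇒ T)  = ren ρ S ⇒ ren ρ T
ren ρ (∀' T)   = ∀' (ren (liftR ρ) T)
ren ρ (S ∧ T)  = ren ρ S ∧ ren ρ T

wk : ∀ {n} → Ty n → Ty (suc n)
wk = ren suc

Sub : ℕ → ℕ → Set
Sub m n = Fin m → Ty n

liftS : ∀ {m n} → Sub m n → Sub (suc m) (suc n)
liftS σ zero    = var zero
liftS σ (suc i) = wk (σ i)

sub : ∀ {m n} → Sub m n → Ty m → Ty n
sub σ ⊤'       = ⊤'
sub σ (var i)  = σ i
sub σ (S ⇒ T)  = sub σ S ⇒ sub σ T
sub σ (∀' T)   = ∀' (sub (liftS σ) T)
sub σ (S ∧ T)  = sub σ S ∧ sub σ T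

-- Mixed substitution: σ⁻ used at negative positions, σ⁺ at positive ones;
-- the two are swapped on the domain of an arrow.
msub : ∀ {m n} → Sub m n → Sub m n → Ty m → Ty n
msub σ⁻ σ⁺ ⊤'       = ⊤'
msub σ⁻ σ⁺ (var i)  = σ⁺ i
msub σ⁻ σ⁺ (S ⇒ T)  = msub σ⁺ σ⁻ S ⇒ msub σ⁻ σ⁺ T
msub σ⁻ σ⁺ (∀' T)   = ∀' (msub (liftS σ⁻) (liftS σ⁺) T)
msub σ⁻ σ⁺ (S ∧ T)  = msub σ⁻ σ⁺ S ∧ msub σ⁻ σ⁺ T

single : ∀ {n} → Ty (suc n) → Sub (suc n) (suc n)
single R zero    = R
single R (suc i) = var (suc i)

_[_/X] : ∀ {n} → Ty (suc n) → Ty (suc n) → Ty (suc n)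
T [ R /X] = sub (single R) T

_[_,_/X] : ∀ {n} → Ty (suc n) → Ty (suc n) → Ty (suc n) → Ty (suc n)
T [ S₋ , S₊ /X] = msub (single S₋) (single S₊) T

_[_/X⁻] : ∀ {n} → Ty (suc n) → Ty (suc n) → Ty (suc n)
T [ R /X⁻] = T [ R , var zero /X]

-- Contexts: sequences of X<:T and x:T assumptions; Ctx n has n type variables.
-- (Well-formedness is built in by scoping: each type only mentions earlier type variables.)
data Ctx : ℕ → Set where
  ∅     : Ctx zero
  _,<:_ : ∀ {n} → Ctx n → Ty n → Ctx (suc n)
  _,∶_  : ∀ {n} → Ctx n → Ty n → Ctx n

data _∋_<:_ : ∀ {n} → Ctx n → Fin n → Ty n → Set where
  here  : ∀ {n} {Θ : Ctx n} {T : Ty n} → (Θ ,<: T) ∋ zero <: wk T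
  thereX : ∀ {n} {Θ : Ctx n} {X : Fin n} {T U : Ty n} →
           Θ ∋ X <: T → (Θ ,<: U) ∋ suc X <: wk T
  therex : ∀ {n} {Θ : Ctx n} {X : Fin n} {T U : Ty n} →
           Θ ∋ X <: T → (Θ ,∶ U) ∋ X <: T

data _⊢_<:_ : ∀ {n} → Ctx n → Ty n → Ty n → Set where
  SVar   : ∀ {n} {Θ : Ctx n} {X T} → Θ ∋ X <: T → Θ ⊢ var X <: T
  STop   : ∀ {n} {Θ : Ctx n} {T} → Θ ⊢ T <: ⊤'
  SRefl  : ∀ {n} {Θ : Ctx n} {T} → Θ ⊢ T <: T
  STrans : ∀ {n} {Θ : Ctx n} {S U T} → Θ ⊢ S <: U → Θ ⊢ U <: T → Θ ⊢ S <: T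
  SArr   : ∀ {n} {Θ : Ctx n} {S S' T T'} →
           Θ ⊢ S' <: S → Θ ⊢ T <: T' → Θ ⊢ (S ⇒ T) <: (S' ⇒ T')
  SAll   : ∀ {n} {Θ : Ctx n} {S T} → (Θ ,<: ⊤') ⊢ S <: T → Θ ⊢ ∀' S <: ∀' T
  SMeetL : ∀ {n} {Θ : Ctx n} {S S'} → Θ ⊢ (S ∧ S') <: S
  SMeetR : ∀ {n} {Θ : Ctx n} {S S'} → Θ ⊢ (S ∧ S') <: S'
  SMeet  : ∀ {n} {Θ : Ctx n} {T S S'} → Θ ⊢ T <: S → Θ ⊢ T <: S' → Θ ⊢ T <: (S ∧ S')

-- Substituting X ∧ S₀ for X discharges the bound X <: S₀ (as X ∧ S₀ <: S₀), so the
-- substitution lemma moves S₁ <: T₁ into the context Θ, X <: ⊤. It remains to compare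
-- T₁[X ∧ S₀/X] with T₁[X ∧ T₀/X⁻]: mixed substitution is covariant in the positive and
-- contravariant in the negative substituend, and X ∧ S₀ <: X and X ∧ T₀ <: X ∧ S₀.
module Submission where

open import Defs
open import Data.Nat using (ℕ)
open import Data.Fin using (zero; suc)
open import Relation.Binary.PropositionalEquality
  using (_≡_; refl; sym; trans; cong; cong₂; subst)

private
  variable
    l m n : ℕ

ren-fusion : ∀ {ρ₁ : Ren l m} {ρ₂ : Ren m n} {ρ : Ren l n} →
  (∀ i → ρ₂ (ρ₁ i) ≡ ρ i) → ∀ T → ren ρ₂ (ren ρ₁ T) ≡ ren ρ T
ren-fusion h ⊤'      = refl
ren-fusion h (var i) = cong var (h i)
ren-fusion h (S ⇒ T) = cong₂ _⇒_ (ren-fusion h S) (ren-fusion h T)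
ren-fusion h (S ∧ T) = cong₂ _∧_ (ren-fusion h S) (ren-fusion h T)
ren-fusion {ρ₁ = ρ₁} {ρ₂} {ρ} h (∀' T) = cong ∀' (ren-fusion h′ T)
  where
  h′ : ∀ i → liftR ρ₂ (liftR ρ₁ i) ≡ liftR ρ i
  h′ zero    = refl
  h′ (suc i) = cong suc (h i)

ren-liftR-wk : (ρ : Ren m n) (T : Ty m) → ren (liftR ρ) (wk T) ≡ wk (ren ρ T)
ren-liftR-wk ρ T = trans (ren-fusion (λ _ → refl) T) (sym (ren-fusion (λ _ → refl) T))

sub-ren-fusion : ∀ {ρ : Ren l m} {σ : Sub m n} {τ : Sub l n} →
  (∀ i → σ (ρ i) ≡ τ i) → ∀ T → sub σ (ren ρ T) ≡ sub τ T
sub-ren-fusion h ⊤'      = refl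
sub-ren-fusion h (var i) = h i
sub-ren-fusion h (S ⇒ T) = cong₂ _⇒_ (sub-ren-fusion h S) (sub-ren-fusion h T)
sub-ren-fusion h (S ∧ T) = cong₂ _∧_ (sub-ren-fusion h S) (sub-ren-fusion h T)
sub-ren-fusion {ρ = ρ} {σ} {τ} h (∀' T) = cong ∀' (sub-ren-fusion h′ T)
  where
  h′ : ∀ i → liftS σ (liftR ρ i) ≡ liftS τ i
  h′ zero    = refl
  h′ (suc i) = cong wk (h i)

ren-sub-fusion : ∀ {σ : Sub l m} {ρ : Ren m n} {τ : Sub l n} →
  (∀ i → ren ρ (σ i) ≡ τ i) → ∀ T → ren ρ (sub σ T) ≡ sub τ T
ren-sub-fusion h ⊤'      = refl
ren-sub-fusion h (var i) = h i
ren-sub-fusion h (S ⇒ T) = cong₂ _⇒_ (ren-sub-fusion h S) (ren-sub-fusion h T)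
ren-sub-fusion h (S ∧ T) = cong₂ _∧_ (ren-sub-fusion h S) (ren-sub-fusion h T)
ren-sub-fusion {σ = σ} {ρ} {τ} h (∀' T) = cong ∀' (ren-sub-fusion h′ T)
  where
  h′ : ∀ i → ren (liftR ρ) (liftS σ i) ≡ liftS τ i
  h′ zero    = refl
  h′ (suc i) = trans (ren-liftR-wk ρ (σ i)) (cong wk (h i))

sub-liftS-wk : (σ : Sub m n) (T : Ty m) → sub (liftS σ) (wk T) ≡ wk (sub σ T)
sub-liftS-wk σ T =
  trans (sub-ren-fusion (λ _ → refl) T) (sym (ren-sub-fusion (λ _ → refl) T))

sub-renaming : ∀ {σ : Sub m n} {ρ : Ren m n} →
  (∀ i → σ i ≡ var (ρ i)) → ∀ T → sub σ T ≡ ren ρ T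
sub-renaming h ⊤'      = refl
sub-renaming h (var i) = h i
sub-renaming h (S ⇒ T) = cong₂ _⇒_ (sub-renaming h S) (sub-renaming h T)
sub-renaming h (S ∧ T) = cong₂ _∧_ (sub-renaming h S) (sub-renaming h T)
sub-renaming {σ = σ} {ρ} h (∀' T) = cong ∀' (sub-renaming h′ T)
  where
  h′ : ∀ i → liftS σ i ≡ var (liftR ρ i)
  h′ zero    = refl
  h′ (suc i) = cong wk (h i)

single-wk : (R : Ty (ℕ.suc n)) (T : Ty n) → sub (single R) (wk T) ≡ wk T
single-wk R T = trans (sub-ren-fusion (λ _ → refl) T) (sub-renaming (λ _ → refl) T)

sub≡msub : (σ : Sub m n) (T : Ty m) → sub σ T ≡ msub σ σ T
sub≡msub σ ⊤'      = refl
sub≡msub σ (var i) = refl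
sub≡msub σ (S ⇒ T) = cong₂ _⇒_ (sub≡msub σ S) (sub≡msub σ T)
sub≡msub σ (∀' T)  = cong ∀' (sub≡msub (liftS σ) T)
sub≡msub σ (S ∧ T) = cong₂ _∧_ (sub≡msub σ S) (sub≡msub σ T)

[/X]≡[,/X] : (T R : Ty (ℕ.suc n)) → T [ R /X] ≡ T [ R , R /X]
[/X]≡[,/X] T R = sub≡msub (single R) T

BoundPreservingRen : Ctx m → Ctx n → Ren m n → Set
BoundPreservingRen Γ Δ ρ = ∀ {X T} → Γ ∋ X <: T → Δ ∋ ρ X <: ren ρ T

liftR-preservesBounds : ∀ {Γ : Ctx m} {Δ : Ctx n} {ρ : Ren m n} {U : Ty m} →
  BoundPreservingRen Γ Δ ρ → BoundPreservingRen (Γ ,<: U) (Δ ,<: ren ρ U) (liftR ρ)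
liftR-preservesBounds {Δ = Δ} {ρ} {U} ok here =
  subst ((Δ ,<: ren ρ U) ∋ zero <:_) (sym (ren-liftR-wk ρ U)) here
liftR-preservesBounds {ρ = ρ} ok (thereX {T = T} p) =
  subst (_ ∋ _ <:_) (sym (ren-liftR-wk ρ T)) (thereX (ok p))

<:-ren : ∀ {Γ : Ctx m} {Δ : Ctx n} {ρ : Ren m n} →
  BoundPreservingRen Γ Δ ρ → ∀ {S T} → Γ ⊢ S <: T → Δ ⊢ ren ρ S <: ren ρ T
<:-ren ok (SVar p)     = SVar (ok p)
<:-ren ok STop         = STop
<:-ren ok SRefl        = SRefl
<:-ren ok (STrans d e) = STrans (<:-ren ok d) (<:-ren ok e)
<:-ren ok (SArr d e)   = SArr (<:-ren ok d) (<:-ren ok e)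
<:-ren ok (SAll d)     = SAll (<:-ren (liftR-preservesBounds ok) d)
<:-ren ok SMeetL       = SMeetL
<:-ren ok SMeetR       = SMeetR
<:-ren ok (SMeet d e)  = SMeet (<:-ren ok d) (<:-ren ok e)

<:-wk : ∀ {Θ : Ctx n} {U S T} → Θ ⊢ S <: T → (Θ ,<: U) ⊢ wk S <: wk T
<:-wk = <:-ren thereX

BoundPreservingSub : Ctx m → Ctx n → Sub m n → Set
BoundPreservingSub Γ Δ σ = ∀ {X T} → Γ ∋ X <: T → Δ ⊢ σ X <: sub σ T

liftS-preservesBounds : ∀ {Γ : Ctx m} {Δ : Ctx n} {σ : Sub m n} {U : Ty m} →
  BoundPreservingSub Γ Δ σ → BoundPreservingSub (Γ ,<: U) (Δ ,<: sub σ U) (liftS σ)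
liftS-preservesBounds {Δ = Δ} {σ} {U} ok here =
  subst ((Δ ,<: sub σ U) ⊢ var zero <:_) (sym (sub-liftS-wk σ U)) (SVar here)
liftS-preservesBounds {σ = σ} ok (thereX {T = T} p) =
  subst (_ ⊢ _ <:_) (sym (sub-liftS-wk σ T)) (<:-wk (ok p))

<:-sub : ∀ {Γ : Ctx m} {Δ : Ctx n} {σ : Sub m n} →
  BoundPreservingSub Γ Δ σ → ∀ {S T} → Γ ⊢ S <: T → Δ ⊢ sub σ S <: sub σ T
<:-sub ok (SVar p)     = ok p
<:-sub ok STop         = STop
<:-sub ok SRefl        = SRefl
<:-sub ok (STrans d e) = STrans (<:-sub ok d) (<:-sub ok e)
<:-sub ok (SArr d e)   = SArr (<:-sub ok d) (<:-sub ok e)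
<:-sub ok (SAll d)     = SAll (<:-sub (liftS-preservesBounds ok) d)
<:-sub ok SMeetL       = SMeetL
<:-sub ok SMeetR       = SMeetR
<:-sub ok (SMeet d e)  = SMeet (<:-sub ok d) (<:-sub ok e)

meetBound-preservesBounds : ∀ {Θ : Ctx n} {U V : Ty n} →
  BoundPreservingSub (Θ ,<: U) (Θ ,<: V) (single (var zero ∧ wk U))
meetBound-preservesBounds {U = U} here =
  subst (_ ⊢ var zero ∧ wk U <:_) (sym (single-wk _ U)) SMeetR
meetBound-preservesBounds (thereX {T = T} p) =
  subst (_ ⊢ _ <:_) (sym (single-wk _ T)) (SVar (thereX p))

<:-[meetBound/X] : ∀ {Θ : Ctx n} {U V : Ty n} {S T} → (Θ ,<: U) ⊢ S <: T →
  (Θ ,<: V) ⊢ (S [ var zero ∧ wk U /X]) <: (T [ var zero ∧ wk U /X])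
<:-[meetBound/X] = <:-sub meetBound-preservesBounds

_⊢_≤ˢ_ : Ctx n → Sub m n → Sub m n → Set
Δ ⊢ σ ≤ˢ τ = ∀ i → Δ ⊢ σ i <: τ i

liftS-mono : ∀ {Δ : Ctx n} {U} {σ τ : Sub m n} →
  Δ ⊢ σ ≤ˢ τ → (Δ ,<: U) ⊢ liftS σ ≤ˢ liftS τ
liftS-mono h zero    = SRefl
liftS-mono h (suc i) = <:-wk (h i)

single-mono : ∀ {Δ : Ctx (ℕ.suc n)} {R R′} → Δ ⊢ R <: R′ → Δ ⊢ single R ≤ˢ single R′
single-mono d zero    = d
single-mono d (suc i) = SRefl

msub-mono : ∀ {Δ : Ctx n} {σ⁻ σ⁺ τ⁻ τ⁺ : Sub m n} →
  Δ ⊢ τ⁻ ≤ˢ σ⁻ → Δ ⊢ σ⁺ ≤ˢ τ⁺ → ∀ T → Δ ⊢ msub σ⁻ σ⁺ T <: msub τ⁻ τ⁺ T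
msub-mono h⁻ h⁺ ⊤'      = SRefl
msub-mono h⁻ h⁺ (var i) = h⁺ i
msub-mono h⁻ h⁺ (S ⇒ T) = SArr (msub-mono h⁺ h⁻ S) (msub-mono h⁻ h⁺ T)
msub-mono h⁻ h⁺ (∀' T)  = SAll (msub-mono (liftS-mono h⁻) (liftS-mono h⁺) T)
msub-mono h⁻ h⁺ (S ∧ T) =
  SMeet (STrans SMeetL (msub-mono h⁻ h⁺ S)) (STrans SMeetR (msub-mono h⁻ h⁺ T))

<:-[,/X] : ∀ {Δ : Ctx (ℕ.suc n)} {R₋ R₊ R₋′ R₊′} →
  Δ ⊢ R₋′ <: R₋ → Δ ⊢ R₊ <: R₊′ → ∀ T → Δ ⊢ (T [ R₋ , R₊ /X]) <: (T [ R₋′ , R₊′ /X])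
<:-[,/X] d₋ d₊ = msub-mono (single-mono d₋) (single-mono d₊)

∧-monoʳ-<: : ∀ {Θ : Ctx n} {R S T} → Θ ⊢ S <: T → Θ ⊢ (R ∧ S) <: (R ∧ T)
∧-monoʳ-<: d = SMeet SMeetL (STrans SMeetR d)

mainTheorem19 : ∀ {n} (Θ : Ctx n) (S₀ T₀ : Ty n) (S₁ T₁ : Ty (ℕ.suc n)) →
    Θ ⊢ T₀ <: S₀ →
    (Θ ,<: S₀) ⊢ S₁ <: T₁ →
    Θ ⊢ ∀' (S₁ [ var zero ∧ wk S₀ /X]) <: ∀' (T₁ [ var zero ∧ wk T₀ /X⁻])
mainTheorem19 Θ S₀ T₀ S₁ T₁ T₀<:S₀ S₁<:T₁ = SAll (STrans (<:-[meetBound/X] S₁<:T₁) T₁-step)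
  where
  T₁-step : (Θ ,<: ⊤') ⊢ (T₁ [ var zero ∧ wk S₀ /X]) <: (T₁ [ var zero ∧ wk T₀ /X⁻])
  T₁-step = subst (λ L → (Θ ,<: ⊤') ⊢ L <: (T₁ [ var zero ∧ wk T₀ /X⁻]))
                  (sym ([/X]≡[,/X] T₁ _))
                  (<:-[,/X] (∧-monoʳ-<: (<:-wk T₀<:S₀)) SMeetL T₁)
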